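{- If $A$ is a centrally supplemented Heyting algebra, then its MacNeille completion $\overline{A}$ is again a centrally supplemented Heyting algebra and $A$ is a supplemented Heyting subalgebra of $\overline{A}$ (i.e., the embedding preserves the Heyting operations and supplements).
   Context: For an element $a$ of a bounded distributive lattice $D$, the supplement $a^+$ (if it exists) is the least element whose join with $a$ is $1$; $D$ is supplemented if every element has one, and centrally supplemented if it is supplemented and satisfies $(x\vee y)^+=x^+\wedge y^+$ for all $x,y$. -}

module Defs where

open import Level using (Level; _⊔_; suc; Lift; lift)
open import Data.Product using (Σ; Σ-syntax; ∃; ∃-syntax; _×_; _,_; proj₁)
open import Relation.Unary using (Pred)
open import Relation.Binary.Lattice.Bundles using (HeytingAlgebra)
open import Relation.Binary.Lattice.Structures using (IsHeytingAlgebra)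

module _ {c ℓ₁ ℓ₂ : Level} (H : HeytingAlgebra c ℓ₁ ℓ₂) where
  open HeytingAlgebra H

  IsSupplement : Carrier → Carrier → Set (c ⊔ ℓ₁ ⊔ ℓ₂)
  IsSupplement a s = ((a ∨ s) ≈ ⊤) × (∀ x → (a ∨ x) ≈ ⊤ → s ≤ x)

  Supplemented : Set (c ⊔ ℓ₁ ⊔ ℓ₂)
  Supplemented = ∀ a → ∃[ s ] IsSupplement a s

  CentrallySupplemented : Set (c ⊔ ℓ₁ ⊔ ℓ₂)
  CentrallySupplemented =
    Supplemented ×
    (∀ x y s t u → IsSupplement x s → IsSupplement y t →
       IsSupplement (x ∨ y) u → u ≈ (s ∧ t))

-- The MacNeille completion (Dedekind–MacNeille completion by cuts):
-- the normal ideals S = L(U(S)) of the underlying poset, ordered by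
-- inclusion, with the embedding a ↦ ↓a.

module MacNeille {c ℓ₁ ℓ₂ : Level} (H : HeytingAlgebra c ℓ₁ ℓ₂) where
  open HeytingAlgebra H

  ℓ : Level
  ℓ = c ⊔ ℓ₂

  Ub : Pred Carrier ℓ → Pred Carrier ℓ
  Ub S a = ∀ {x} → S x → x ≤ a

  Lb : Pred Carrier ℓ → Pred Carrier ℓ
  Lb T a = ∀ {x} → T x → a ≤ x

  -- normal ideal (cut): L(U(S)) ⊆ S   (S ⊆ L(U(S)) always holds)
  IsNormal : Pred Carrier ℓ → Set ℓ
  IsNormal S = ∀ {a} → Lb (Ub S) a → S a

  Cut : Set (suc ℓ)
  Cut = Σ (Pred Carrier ℓ) IsNormal

  _⊆ᴹ_ : Cut → Cut → Set ℓ
  (S , _) ⊆ᴹ (T , _) = ∀ {x} → S x → T x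

  _≈ᴹ_ : Cut → Cut → Set ℓ
  X ≈ᴹ Y = (X ⊆ᴹ Y) × (Y ⊆ᴹ X)

  ↓ : Carrier → Cut
  ↓ a = (λ x → Lift c (x ≤ a)) , (λ lb → lift (lb (λ {x} (lift x≤a) → x≤a)))

  -- A Heyting algebra structure on Ā (with its fixed order ⊆ᴹ and
  -- equality ≈ᴹ; the operations are determined by the order).
  record HeytingStructure : Set (suc ℓ) where
    field
      _∨ᴹ_ _∧ᴹ_ _⇨ᴹ_ : Cut → Cut → Cut
      ⊤ᴹ ⊥ᴹ : Cut
      isHeytingᴹ : IsHeytingAlgebra _≈ᴹ_ _⊆ᴹ_ _∨ᴹ_ _∧ᴹ_ _⇨ᴹ_ ⊤ᴹ ⊥ᴹ

    bundle : HeytingAlgebra (suc ℓ) ℓ ℓ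
    bundle = record { isHeytingAlgebra = isHeytingᴹ }

  record CompletionResult : Set (suc ℓ ⊔ ℓ₁) where
    field
      structure : HeytingStructure
    open HeytingStructure structure public
    field
      centrallySupplemented : CentrallySupplemented bundle
      ↓-reflects-≤ : ∀ a b → ↓ a ⊆ᴹ ↓ b → a ≤ b
      ↓-preserves-≤ : ∀ a b → a ≤ b → ↓ a ⊆ᴹ ↓ b
      ↓-⊤ : ↓ ⊤ ≈ᴹ ⊤ᴹ
      ↓-⊥ : ↓ ⊥ ≈ᴹ ⊥ᴹ
      ↓-∨ : ∀ a b → ↓ (a ∨ b) ≈ᴹ (↓ a ∨ᴹ ↓ b)
      ↓-∧ : ∀ a b → ↓ (a ∧ b) ≈ᴹ (↓ a ∧ᴹ ↓ b)
      ↓-⇨ : ∀ a b → ↓ (a ⇨ b) ≈ᴹ (↓ a ⇨ᴹ ↓ b)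
      ↓-supplement : ∀ a s → IsSupplement H a s → IsSupplement bundle (↓ a) (↓ s)

module Submission where

-- The cuts of any Heyting algebra A form a Heyting algebra Ā: meets are
-- intersections, the join of X and Y is the cut LU(X ∪ Y) generated by the
-- union, and X ⇨ Y = {a | a ∧ x ∈ Y for all x ∈ X}; the embedding a ↦ ↓a
-- preserves all of these.  Two facts about cuts drive the rest: X ∨ Y = ⊤ in
-- Ā iff ⊤ is the only common upper bound of X and Y, and generating a cut
-- commutes with meets (if p ∧ q ≤ g on P × Q then a ≤ g on LU(P) ∩ LU(Q)).
-- If A is supplemented, the supplement of a cut X is the cut generated by the
-- elements below u⁺ for some upper bound u of X.  When A is centrally
-- supplemented, (u ∨ v)⁺ = u⁺ ∧ v⁺ and the meet lemma give X⁺ ∧ Y⁺ ⊆ (X ∨ Y)⁺;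
-- since supplements are unique and antitone in any lattice, this single
-- inequality already makes Ā centrally supplemented.  Finally ↓(a⁺) = (↓a)⁺
-- because a is an upper bound of ↓a.

open import Defs
open import Level using (Level; lift; lower)
open import Data.Product using (∃-syntax; _×_; _,_; proj₁; proj₂)
open import Data.Sum using (_⊎_; inj₁; inj₂)
open import Relation.Unary using (Pred)
open import Relation.Binary.Structures using (IsPartialOrder)
open import Relation.Binary.Lattice.Bundles using (HeytingAlgebra)
open import Relation.Binary.Lattice.Definitions using (Supremum; Infimum; Exponential)

module SupplementFacts {c ℓ₁ ℓ₂ : Level} (H : HeytingAlgebra c ℓ₁ ℓ₂) where
  open HeytingAlgebra H
  open import Relation.Binary.Lattice.Properties.JoinSemilattice joinSemilattice
    using (∨-monotonic)
  open import Relation.Binary.Lattice.Properties.MeetSemilattice meetSemilattice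
    using (∧-monotonic)

  above-supplement⇒⊤ : ∀ {v s} → IsSupplement H v s → s ≤ v → ⊤ ≤ v
  above-supplement⇒⊤ (v∨s≈⊤ , _) s≤v =
    trans (reflexive (Eq.sym v∨s≈⊤)) (∨-least refl s≤v)

  supplement-least : ∀ {u s g} → IsSupplement H u s → ⊤ ≤ u ∨ g → s ≤ g
  supplement-least (_ , least) ⊤≤u∨g = least _ (antisym (maximum _) ⊤≤u∨g)

  supplement-antitone : ∀ {x y s t} → x ≤ y →
    IsSupplement H x s → IsSupplement H y t → t ≤ s
  supplement-antitone x≤y (x∨s≈⊤ , _) t-spec =
    supplement-least t-spec (trans (reflexive (Eq.sym x∨s≈⊤)) (∨-monotonic x≤y refl))

  -- A supplement operation with x⁺ ∧ y⁺ ≤ (x ∨ y)⁺ makes H centrally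
  -- supplemented: the reverse inequality is antitonicity, and supplements
  -- are unique, so the law transfers to any choice of supplements.
  centrallySupplemented-from : (_⁺ : Carrier → Carrier) →
    (∀ a → IsSupplement H a (a ⁺)) →
    (∀ x y → (x ⁺ ∧ y ⁺) ≤ (x ∨ y) ⁺) → CentrallySupplemented H
  centrallySupplemented-from _⁺ ⁺-spec ⁺-central =
    (λ a → a ⁺ , ⁺-spec a) , central
    where
      central : ∀ x y s t u → IsSupplement H x s → IsSupplement H y t →
                IsSupplement H (x ∨ y) u → u ≈ (s ∧ t)
      central x y s t u s-spec t-spec u-spec = antisym
        (∧-greatest (supplement-antitone (x≤x∨y x y) s-spec u-spec)
                    (supplement-antitone (y≤x∨y x y) t-spec u-spec))
        (trans (∧-monotonic (proj₂ s-spec (x ⁺) (proj₁ (⁺-spec x)))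
                            (proj₂ t-spec (y ⁺) (proj₁ (⁺-spec y))))
          (trans (⁺-central x y) (proj₂ (⁺-spec (x ∨ y)) u (proj₁ u-spec))))

module Cuts {c ℓ₁ ℓ₂ : Level} (A : HeytingAlgebra c ℓ₁ ℓ₂) where
  open HeytingAlgebra A
  open MacNeille A
  open import Relation.Binary.Lattice.Properties.HeytingAlgebra A
    using (swap-transpose-⇨)

  _∈_ : Carrier → Cut → Set ℓ
  x ∈ X = proj₁ X x

  ⟨_⟩ : Pred Carrier ℓ → Cut
  ⟨ P ⟩ = Lb (Ub P) , λ lb ub → lb (λ a∈LUP → a∈LUP ub)

  generator∈ : ∀ {P x} → P x → x ∈ ⟨ P ⟩
  generator∈ px ub = ub px

  ⟨⟩-least : ∀ {P} (X : Cut) → (∀ {x} → P x → x ∈ X) → ⟨ P ⟩ ⊆ᴹ X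
  ⟨⟩-least (S , normal) P⊆S x∈LUP = normal (λ ub → x∈LUP (λ px → ub (P⊆S px)))

  cut-downward : (X : Cut) → ∀ {x y} → x ≤ y → y ∈ X → x ∈ X
  cut-downward (S , normal) x≤y y∈S = normal (λ ub → trans x≤y (ub y∈S))

  ⊥∈ : (X : Cut) → ⊥ ∈ X
  ⊥∈ (S , normal) = normal (λ _ → minimum _)

  ↓-bounded : ∀ a → Ub (proj₁ (↓ a)) a
  ↓-bounded a (lift x≤a) = x≤a

  _∪_ : Pred Carrier ℓ → Pred Carrier ℓ → Pred Carrier ℓ
  (S ∪ T) a = S a ⊎ T a

  _∧ᴹ_ _∨ᴹ_ _⇨ᴹ_ : Cut → Cut → Cut
  (S , normalS) ∧ᴹ (T , normalT) = (λ a → S a × T a) ,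
    λ lb → normalS (λ ub → lb (λ st → ub (proj₁ st))) ,
           normalT (λ ub → lb (λ st → ub (proj₂ st)))
  X ∨ᴹ Y = ⟨ proj₁ X ∪ proj₁ Y ⟩
  -- If u bounds Y then x ⇨ u bounds X ⇨ Y for each x ∈ X; this makes X ⇨ Y normal.
  (S , _) ⇨ᴹ (T , normalT) = (λ a → ∀ {x} → S x → T (a ∧ x)) ,
    λ lb x∈S → normalT (λ ub →
      transpose-∧ (lb (λ b∈S⇨T → transpose-⇨ (ub (b∈S⇨T x∈S)))))

  ⊤ᴹ ⊥ᴹ : Cut
  ⊤ᴹ = ↓ ⊤
  ⊥ᴹ = ↓ ⊥

  ≈ᴹ-refl : ∀ {X} → X ≈ᴹ X
  ≈ᴹ-refl = (λ x∈X → x∈X) , (λ x∈X → x∈X)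

  ⊆ᴹ-isPartialOrder : IsPartialOrder _≈ᴹ_ _⊆ᴹ_
  ⊆ᴹ-isPartialOrder = record
    { isPreorder = record
      { isEquivalence = record
        { refl = λ {X} → ≈ᴹ-refl {X}
        ; sym = λ (X⊆Y , Y⊆X) → Y⊆X , X⊆Y
        ; trans = λ (X⊆Y , Y⊆X) (Y⊆Z , Z⊆Y) →
            (λ x → Y⊆Z (X⊆Y x)) , (λ x → Y⊆X (Z⊆Y x)) }
      ; reflexive = proj₁
      ; trans = λ X⊆Y Y⊆Z x → Y⊆Z (X⊆Y x) }
    ; antisym = _,_ }

  ∨ᴹ-supremum : Supremum _⊆ᴹ_ _∨ᴹ_
  ∨ᴹ-supremum X Y =
    (λ x → generator∈ (inj₁ x)) , (λ y → generator∈ (inj₂ y)) ,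
    λ Z X⊆Z Y⊆Z → ⟨⟩-least Z λ { (inj₁ x) → X⊆Z x ; (inj₂ y) → Y⊆Z y }

  ∧ᴹ-infimum : Infimum _⊆ᴹ_ _∧ᴹ_
  ∧ᴹ-infimum X Y = proj₁ , proj₂ , λ Z Z⊆X Z⊆Y z → Z⊆X z , Z⊆Y z

  ⇨ᴹ-exponential : Exponential _⊆ᴹ_ _∧ᴹ_ _⇨ᴹ_
  ⇨ᴹ-exponential W X Y =
    (λ W∧X⊆Y w x → W∧X⊆Y (cut-downward W (x∧y≤x _ _) w , cut-downward X (x∧y≤y _ _) x)) ,
    (λ W⊆X⇨Y (w , x) → cut-downward Y (∧-greatest refl refl) (W⊆X⇨Y w x))

  cutStructure : HeytingStructure
  cutStructure = record
    { _∨ᴹ_ = _∨ᴹ_ ; _∧ᴹ_ = _∧ᴹ_ ; _⇨ᴹ_ = _⇨ᴹ_ ; ⊤ᴹ = ⊤ᴹ ; ⊥ᴹ = ⊥ᴹ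
    ; isHeytingᴹ = record
      { isBoundedLattice = record
        { isLattice = record
          { isPartialOrder = ⊆ᴹ-isPartialOrder
          ; supremum = ∨ᴹ-supremum
          ; infimum = ∧ᴹ-infimum }
        ; maximum = λ X x∈X → lift (maximum _)
        ; minimum = λ X (lift x≤⊥) → cut-downward X x≤⊥ (⊥∈ X) }
      ; exponential = ⇨ᴹ-exponential } }

  Ā : HeytingAlgebra _ _ _
  Ā = HeytingStructure.bundle cutStructure

  ↓-reflects-≤ : ∀ a b → ↓ a ⊆ᴹ ↓ b → a ≤ b
  ↓-reflects-≤ a b ↓a⊆↓b = lower (↓a⊆↓b (lift refl))

  ↓-preserves-≤ : ∀ a b → a ≤ b → ↓ a ⊆ᴹ ↓ b
  ↓-preserves-≤ a b a≤b (lift x≤a) = lift (trans x≤a a≤b)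

  ↓-∨ : ∀ a b → ↓ (a ∨ b) ≈ᴹ (↓ a ∨ᴹ ↓ b)
  ↓-∨ a b =
    (λ (lift x≤a∨b) ub →
       trans x≤a∨b (∨-least (ub (inj₁ (lift refl))) (ub (inj₂ (lift refl))))) ,
    (λ x∈LU → lift (x∈LU λ { (inj₁ (lift y≤a)) → trans y≤a (x≤x∨y a b)
                           ; (inj₂ (lift y≤b)) → trans y≤b (y≤x∨y a b) }))

  ↓-∧ : ∀ a b → ↓ (a ∧ b) ≈ᴹ (↓ a ∧ᴹ ↓ b)
  ↓-∧ a b =
    (λ (lift x≤a∧b) → lift (trans x≤a∧b (x∧y≤x a b)) , lift (trans x≤a∧b (x∧y≤y a b))) ,
    (λ (lift x≤a , lift x≤b) → lift (∧-greatest x≤a x≤b))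

  ↓-⇨ : ∀ a b → ↓ (a ⇨ b) ≈ᴹ (↓ a ⇨ᴹ ↓ b)
  ↓-⇨ a b =
    (λ (lift x≤a⇨b) (lift y≤a) →
       lift (trans (∧-greatest (x∧y≤x _ _) (trans (x∧y≤y _ _) y≤a)) (transpose-∧ x≤a⇨b))) ,
    (λ x∈↓a⇨↓b → lift (transpose-⇨ (lower (x∈↓a⇨↓b (lift refl)))))

  join-⊤-intro : (X Y : Cut) →
    (∀ v → Ub (proj₁ X) v → Ub (proj₁ Y) v → ⊤ ≤ v) → (X ∨ᴹ Y) ≈ᴹ ⊤ᴹ
  join-⊤-intro X Y only-⊤ =
    (λ _ → lift (maximum _)) ,
    (λ (lift x≤⊤) {v} ub → trans x≤⊤ (only-⊤ v (λ x → ub (inj₁ x)) (λ y → ub (inj₂ y))))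

  join-⊤-elim : (X Y : Cut) →
    (X ∨ᴹ Y) ≈ᴹ ⊤ᴹ → ∀ v → Ub (proj₁ X) v → Ub (proj₁ Y) v → ⊤ ≤ v
  join-⊤-elim X Y (_ , ⊤⊆X∨Y) v ubX ubY =
    ⊤⊆X∨Y (lift refl) λ { (inj₁ x) → ubX x ; (inj₂ y) → ubY y }

  Ub-∨ᴹ : (X Y : Cut) → ∀ {u v} →
    Ub (proj₁ X) u → Ub (proj₁ Y) v → Ub (proj₁ (X ∨ᴹ Y)) (u ∨ v)
  Ub-∨ᴹ X Y {u} {v} ubX ubY x∈LU =
    x∈LU λ { (inj₁ x) → trans (ubX x) (x≤x∨y u v) ; (inj₂ y) → trans (ubY y) (y≤x∨y u v) }

  -- Generating cuts commutes with meets (this uses that A is Heyting):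
  -- for q ∈ Q, q ⇨ g bounds P, so a ∧ q ≤ g; hence a ⇨ g bounds Q and a ≤ g.
  ⟨⟩-meet : ∀ {P Q g} → (∀ {p q} → P p → Q q → (p ∧ q) ≤ g) →
    ∀ {a} → a ∈ ⟨ P ⟩ → a ∈ ⟨ Q ⟩ → a ≤ g
  ⟨⟩-meet {Q = Q} {g = g} bound {a} a∈⟨P⟩ a∈⟨Q⟩ =
    trans (∧-greatest refl refl) (transpose-∧ a≤a⇨g)
    where
      a≤q⇨g : ∀ {q} → Q q → a ≤ (q ⇨ g)
      a≤q⇨g q∈Q = a∈⟨P⟩ (λ p∈P → transpose-⇨ (bound p∈P q∈Q))

      a≤a⇨g : a ≤ (a ⇨ g)
      a≤a⇨g = a∈⟨Q⟩ (λ q∈Q → swap-transpose-⇨ (transpose-∧ (a≤q⇨g q∈Q)))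

module CutSupplements {c ℓ₁ ℓ₂ : Level} (A : HeytingAlgebra c ℓ₁ ℓ₂)
                      (supplemented : Supplemented A) where
  open HeytingAlgebra A
  open MacNeille A
  open Cuts A
  open SupplementFacts A using (above-supplement⇒⊤; supplement-least)

  infix 30 _⁺ _⁺ᴹ

  _⁺ : Carrier → Carrier
  a ⁺ = proj₁ (supplemented a)

  ⁺-spec : ∀ a → IsSupplement A a (a ⁺)
  ⁺-spec a = proj₂ (supplemented a)

  SupplementGenerators : Cut → Pred Carrier ℓ
  SupplementGenerators X a = ∃[ u ] Ub (proj₁ X) u × a ≤ u ⁺

  _⁺ᴹ : Cut → Cut
  X ⁺ᴹ = ⟨ SupplementGenerators X ⟩

  -- A common upper bound v of X and X⁺ᴹ lies above v⁺, so it is ⊤.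
  ⁺ᴹ-join : (X : Cut) → (X ∨ᴹ X ⁺ᴹ) ≈ᴹ ⊤ᴹ
  ⁺ᴹ-join X = join-⊤-intro X (X ⁺ᴹ) λ v ubX ubX⁺ →
    above-supplement⇒⊤ (⁺-spec v) (ubX⁺ (generator∈ (v , (λ {x} → ubX {x}) , refl)))

  -- If X ∨ Y = ⊤ then u⁺ ∈ Y for every upper bound u of X, because for an
  -- upper bound g of Y the common upper bound u ∨ g must be ⊤.
  ⁺ᴹ-least : (X Y : Cut) → (X ∨ᴹ Y) ≈ᴹ ⊤ᴹ → X ⁺ᴹ ⊆ᴹ Y
  ⁺ᴹ-least X Y X∨Y≈⊤ = ⟨⟩-least Y λ (u , ubX , a≤u⁺) →
    cut-downward Y a≤u⁺ (proj₂ Y λ {g} ubY →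
      supplement-least (⁺-spec u)
        (join-⊤-elim X Y X∨Y≈⊤ (u ∨ g)
          (λ x → trans (ubX x) (x≤x∨y u g)) (λ y → trans (ubY y) (y≤x∨y u g))))

  ⁺ᴹ-spec : (X : Cut) → IsSupplement Ā X (X ⁺ᴹ)
  ⁺ᴹ-spec X = ⁺ᴹ-join X , ⁺ᴹ-least X

  ⁺ᴹ-central : (∀ u v → (u ∨ v) ⁺ ≈ (u ⁺ ∧ v ⁺)) →
    (X Y : Cut) → ((X ⁺ᴹ) ∧ᴹ (Y ⁺ᴹ)) ⊆ᴹ ((X ∨ᴹ Y) ⁺ᴹ)
  ⁺ᴹ-central central X Y (a∈X⁺ , a∈Y⁺) {g} ub = ⟨⟩-meet bound a∈X⁺ a∈Y⁺
    where
      bound : ∀ {p q} → SupplementGenerators X p → SupplementGenerators Y q →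
              (p ∧ q) ≤ g
      bound (u , ubX , p≤u⁺) (v , ubY , q≤v⁺) =
        trans (∧-greatest (trans (x∧y≤x _ _) p≤u⁺) (trans (x∧y≤y _ _) q≤v⁺))
          (trans (reflexive (Eq.sym (central u v)))
                 (ub (u ∨ v , (λ {x} → Ub-∨ᴹ X Y ubX ubY {x}) , refl)))

  -- ↓ s ⊆ (↓ a)⁺ᴹ since s ≤ a⁺ and a bounds ↓ a.
  ↓-supplement : ∀ a s → IsSupplement A a s → IsSupplement Ā (↓ a) (↓ s)
  ↓-supplement a s s-spec@(a∨s≈⊤ , _) =
    join-⊤-intro (↓ a) (↓ s)
      (λ v ub↓a ub↓s → trans (reflexive (Eq.sym a∨s≈⊤))
                             (∨-least (ub↓a (lift refl)) (ub↓s (lift refl)))) ,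
    λ Y ↓a∨Y≈⊤ (lift x≤s) → ⁺ᴹ-least (↓ a) Y ↓a∨Y≈⊤
      (generator∈ (a , (λ {x} → ↓-bounded a {x}) ,
                   trans x≤s (proj₂ s-spec (a ⁺) (proj₁ (⁺-spec a)))))

proposition2p9 : ∀ {c ℓ₁ ℓ₂} (A : HeytingAlgebra c ℓ₁ ℓ₂) →
    CentrallySupplemented A → MacNeille.CompletionResult A
proposition2p9 A (supplemented , central) = record
  { structure = cutStructure
  ; centrallySupplemented =
      SupplementFacts.centrallySupplemented-from Ā _⁺ᴹ ⁺ᴹ-spec (⁺ᴹ-central ⁺-central)
  ; ↓-reflects-≤ = ↓-reflects-≤
  ; ↓-preserves-≤ = ↓-preserves-≤
  ; ↓-⊤ = ≈ᴹ-refl {↓ ⊤}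
  ; ↓-⊥ = ≈ᴹ-refl {↓ ⊥}
  ; ↓-∨ = ↓-∨
  ; ↓-∧ = ↓-∧
  ; ↓-⇨ = ↓-⇨
  ; ↓-supplement = ↓-supplement
  }
  where
    open HeytingAlgebra A using (_∨_; _∧_; _≈_; ⊤; ⊥)
    open MacNeille A using (↓)
    open Cuts A
    open CutSupplements A supplemented

    ⁺-central : ∀ u v → (u ∨ v) ⁺ ≈ (u ⁺ ∧ v ⁺)
    ⁺-central u v = central u v _ _ _ (⁺-spec u) (⁺-spec v) (⁺-spec (u ∨ v))
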